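{- Let $n\ge 2$ and let $M$ be an $n\times n$ integer matrix such that $\det M=1$ and $\det(M^{(3)})=1$. Then each of the following integer matrices $N$ also satisfies $\det N=1$ and $\det(N^{(3)})=1$: (i) $N=M^{T}$; (ii) $N=E_{i_1}(-1)E_{i_2}(-1)M$ and $N=M E_{i_1}(-1)E_{i_2}(-1)$, where $i_1,i_2\in\{1,\ldots,n\}$ with $i_1\neq i_2$; (iii) $N=E_{i_1i_2}E_{j_1j_2}M$, $N=M E_{i_1i_2}E_{j_1j_2}$ and $N=E_{i_1i_2} M E_{j_1j_2}$, where $i_1,i_2,j_1,j_2\in\{1,\ldots,n\}$ with $i_1\neq i_2$ and $j_1\neq j_2$; (iv) $N=M([i,j],\alpha):=E_i(\alpha) M E_j(\alpha^{ -1})$, where $i,j\in\{1,\ldots,n\}$ and $\alpha$ is a nonzero rational number chosen so that all entries of $E_i(\alpha) M E_j(\alpha^{ -1})$ are integers.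
   Context: For a matrix $M=(m_{ij})$, $M^{(3)}$ denotes the matrix $(m_{ij}^3)$ obtained by replacing each entry by its cube, and $M^T$ is the transpose. $E_{ij}$ denotes the $n\times n$ elementary matrix obtained by interchanging the $i$-th and $j$-th rows of the identity matrix, and $E_i(\alpha)$ denotes the $n\times n$ elementary matrix obtained by multiplying the $i$-th row of the identity matrix by $\alpha$. -}

module Defs where

open import Level using (Level)
open import Data.Nat using (ℕ; zero; suc)
open import Data.Fin using (Fin; zero; suc; punchIn)
open import Data.Fin.Properties using (_≟_)
open import Relation.Nullary using (yes; no)
open import Relation.Binary.PropositionalEquality using (_≡_)
open import Data.Product using (_×_)
open import Algebra.Bundles.Raw using (RawRing)
open import Data.Integer using (ℤ)
import Data.Integer as ℤ
open import Data.Rational using (ℚ)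
import Data.Rational as ℚ

module MatrixOps {c ℓ : Level} (R : RawRing c ℓ) where
  open RawRing R renaming (Carrier to A)

  Mat : ℕ → Set c
  Mat n = Fin n → Fin n → A

  sumFin : {n : ℕ} → (Fin n → A) → A
  sumFin {zero}  f = 0#
  sumFin {suc n} f = f zero + sumFin (λ k → f (suc k))

  _⊗_ : {n : ℕ} → Mat n → Mat n → Mat n
  (M ⊗ N) i j = sumFin (λ k → M i k * N k j)

  transpose : {n : ℕ} → Mat n → Mat n
  transpose M i j = M j i

  cube : {n : ℕ} → Mat n → Mat n
  cube M i j = M i j * M i j * M i j

  sgn : {n : ℕ} → Fin n → A
  sgn zero    = 1#
  sgn (suc j) = - sgn j

  det : {n : ℕ} → Mat n → A
  det {zero}  M = 1#
  det {suc n} M =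
    sumFin (λ j → sgn j * (M zero j * det (λ a b → M (suc a) (punchIn j b))))

  I : {n : ℕ} → Mat n
  I a b with a ≟ b
  ... | yes _ = 1#
  ... | no  _ = 0#

  swapIx : {n : ℕ} → Fin n → Fin n → Fin n → Fin n
  swapIx i j a with a ≟ i
  ... | yes _ = j
  ... | no  _ with a ≟ j
  ...   | yes _ = i
  ...   | no  _ = a

  Eswap : {n : ℕ} → Fin n → Fin n → Mat n
  Eswap i j a b = I (swapIx i j a) b

  Escale : {n : ℕ} → Fin n → A → Mat n
  Escale i α a b with a ≟ i
  ... | yes _ = α * I a b
  ... | no  _ = I a b

module ℤM = MatrixOps ℤ.+-*-rawRing
module ℚM = MatrixOps ℚ.+-*-rawRing

toℚMat : {n : ℕ} → ℤM.Mat n → ℚM.Mat n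
toℚMat M a b = M a b ℚ./ 1

Good : {n : ℕ} → ℤM.Mat n → Set
Good N = (ℤM.det N ≡ ℤ.1ℤ) × (ℤM.det (ℤM.cube N) ≡ ℤ.1ℤ)

{-# OPTIONS --safe #-}
-- Transposing, interchanging two rows (or columns) and scaling one row (or column) by c
-- multiply the determinant by 1, -1 and c.  Cubing the entries commutes with permuting
-- rows and columns and turns a scaling by c into a scaling by c³, so the same operations
-- multiply det N⁽³⁾ by 1, -1 and c³.  Each matrix of the theorem is obtained from M by
-- operations whose factors multiply to 1: (-1)(-1) in (ii) and (iii), and α⁻¹α in (iv),
-- where the computation is done over ℚ and pulled back along the injective ring
-- homomorphism ℤ → ℚ.
module Submission where

open import Defs
open import Data.Nat using (ℕ; zero; suc; _≤_)
open import Data.Fin using (Fin; zero; suc; punchIn)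
open import Data.Integer using (ℤ; 1ℤ)
open import Data.Rational using (ℚ; NonZero; 1/_)
open import Data.Product using (_×_; _,_)
open import Relation.Binary.PropositionalEquality using (_≡_; _≢_)

open import Function using (_∘_)
open import Data.Empty using (⊥-elim)
open import Data.Sum using (_⊎_; inj₁; inj₂)
open import Data.Fin.Properties using (_≟_; punchInᵢ≢i)
open import Relation.Nullary using (yes; no)
open import Relation.Binary.Bundles using (Setoid)
open import Algebra.Bundles using (CommutativeRing)
open import Algebra.Morphism.Structures using (IsRingMonomorphism)
import Relation.Binary.PropositionalEquality as ≡
import Relation.Binary.Reasoning.Setoid as SetoidReasoning
import Data.Vec.Functional.Relation.Binary.Equality.Setoid as PointwiseEq
import Data.Integer as ℤ
import Data.Integer.Properties as ℤP
import Data.Rational as ℚ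
import Data.Rational.Properties as ℚP
import Data.Rational.Unnormalised as ℚᵘ
import Data.Rational.Unnormalised.Properties as ℚᵘP

module Determinant {c ℓ} (R : CommutativeRing c ℓ) where
  open CommutativeRing R renaming (Carrier to A) hiding (zero)
  open MatrixOps rawRing public
  open import Algebra.Properties.Ring ring using (-‿distribˡ-*; -‿distribʳ-*; -‿involutive; -‿+-comm; -0#≈0#; -1*x≈-x)
  open import Algebra.Properties.Semiring.Sum semiring
    using (sum; sum-cong-≋; sum-cong-≗; ∑-comm; *-distribˡ-sum; *-distribʳ-sum; sum-remove; sum-replicate-zero)
  open import Algebra.Solver.CommutativeMonoid *-commutativeMonoid using (solve; _⊕_; _⊜_; id)

  module ≈-Reasoning = SetoidReasoning setoid

  Mat-setoid : ℕ → Setoid c ℓ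
  Mat-setoid n = PointwiseEq.≋-setoid (PointwiseEq.≋-setoid setoid n) n

  module ≈ₘ-Reasoning {n : ℕ} = SetoidReasoning (Mat-setoid n)

  infix 4 _≈ₘ_
  _≈ₘ_ : ∀ {n} → Mat n → Mat n → Set ℓ
  _≈ₘ_ {n} = Setoid._≈_ (Mat-setoid n)

  minor : ∀ {n} → Fin (suc n) → Fin (suc n) → Mat (suc n) → Mat n
  minor i j M a b = M (punchIn i a) (punchIn j b)

  permuteRows permuteCols : ∀ {n} → (Fin n → Fin n) → Mat n → Mat n
  permuteRows σ M a b = M (σ a) b
  permuteCols σ M a b = M a (σ b)

  scaleRows scaleCols : ∀ {n} → (Fin n → A) → Mat n → Mat n
  scaleRows d M a b = d a * M a b
  scaleCols d M a b = M a b * d b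

  rowFactor : ∀ {n} → Fin n → A → Fin n → A
  rowFactor zero    c zero    = c
  rowFactor zero    c (suc _) = 1#
  rowFactor (suc _) c zero    = 1#
  rowFactor (suc i) c (suc a) = rowFactor i c a

  infix 8 _³
  _³ : A → A
  x ³ = x * x * x

  sumFin≡sum : ∀ {n} (f : Fin n → A) → sumFin f ≡ sum f
  sumFin≡sum {zero}  f = ≡.refl
  sumFin≡sum {suc n} f = ≡.cong (f zero +_) (sumFin≡sum (λ k → f (suc k)))

  sumFin-cong : ∀ {n} {f g : Fin n → A} → (∀ k → f k ≈ g k) → sumFin f ≈ sumFin g
  sumFin-cong {f = f} {g} f≈g rewrite sumFin≡sum f | sumFin≡sum g = sum-cong-≋ f≈g

  *-distribˡ-sumFin : ∀ {n} x (f : Fin n → A) → x * sumFin f ≈ sumFin (λ k → x * f k)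
  *-distribˡ-sumFin x f rewrite sumFin≡sum f | sumFin≡sum (λ k → x * f k) = *-distribˡ-sum x f

  *-distribʳ-sumFin : ∀ {n} x (f : Fin n → A) → sumFin f * x ≈ sumFin (λ k → f k * x)
  *-distribʳ-sumFin x f rewrite sumFin≡sum f | sumFin≡sum (λ k → f k * x) = *-distribʳ-sum x f

  sumFin²≡sum² : ∀ {m n} (f : Fin m → Fin n → A) → sumFin (λ j → sumFin (f j)) ≡ sum (λ j → sum (f j))
  sumFin²≡sum² f = ≡.trans (sumFin≡sum (λ j → sumFin (f j))) (sum-cong-≗ (λ j → sumFin≡sum (f j)))

  sumFin-comm : ∀ {m n} (f : Fin m → Fin n → A) →
    sumFin (λ j → sumFin (λ k → f j k)) ≈ sumFin (λ k → sumFin (λ j → f j k))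
  sumFin-comm f rewrite sumFin²≡sum² f | sumFin²≡sum² (λ k j → f j k) = ∑-comm f

  sumFin-neg : ∀ {n} {f g : Fin n → A} → (∀ k → f k ≈ - g k) → sumFin f ≈ - sumFin g
  sumFin-neg {zero}  _     = sym -0#≈0#
  sumFin-neg {suc n} f≈-g = trans (+-cong (f≈-g zero) (sumFin-neg (f≈-g ∘ suc))) (-‿+-comm _ _)

  I-cong : ∀ {m n} {a b : Fin m} {a′ b′ : Fin n} →
    (a ≡ b → a′ ≡ b′) → (a′ ≡ b′ → a ≡ b) → I a b ≡ I a′ b′
  I-cong {a = a} {b} {a′} {b′} ⇒ ⇐ with a ≟ b | a′ ≟ b′
  ... | yes _   | yes _    = ≡.refl
  ... | no  _   | no  _    = ≡.refl
  ... | yes a≡b | no a′≢b′ = ⊥-elim (a′≢b′ (⇒ a≡b))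
  ... | no  a≢b | yes a′≡b′ = ⊥-elim (a≢b (⇐ a′≡b′))

  I-refl : ∀ {n} (a : Fin n) → I a a ≡ 1#
  I-refl a with a ≟ a
  ... | yes _   = ≡.refl
  ... | no  a≢a = ⊥-elim (a≢a ≡.refl)

  I-≢ : ∀ {n} {a b : Fin n} → a ≢ b → I a b ≡ 0#
  I-≢ {a = a} {b} a≢b with a ≟ b
  ... | yes a≡b = ⊥-elim (a≢b a≡b)
  ... | no  _   = ≡.refl

  diagonal-comm : ∀ {n} (d : Fin n → A) (a b : Fin n) → d a * I a b ≈ I a b * d b
  diagonal-comm d a b with a ≟ b
  ... | yes ≡.refl = *-comm _ _
  ... | no  _      = trans (zeroʳ _) (sym (zeroˡ _))

  sumFin-δ : ∀ {n} (x : Fin n → A) (a : Fin n) → sumFin (λ k → I a k * x k) ≈ x a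
  sumFin-δ {suc n} x a = begin
    sumFin (λ k → I a k * x k)                          ≡⟨ sumFin≡sum (λ k → I a k * x k) ⟩
    sum (λ k → I a k * x k)                             ≈⟨ sum-remove {i = a} (λ k → I a k * x k) ⟩
    I a a * x a + sum (λ k → I a (punchIn a k) * x (punchIn a k))
      ≈⟨ +-cong (*-congʳ (reflexive (I-refl a))) (sum-cong-≋ off-diagonal) ⟩
    1# * x a + sum {n} (λ _ → 0#)                         ≈⟨ +-cong (*-identityˡ _) (sum-replicate-zero n) ⟩
    x a + 0#                                            ≈⟨ +-identityʳ _ ⟩
    x a                                                 ∎
    where
    open ≈-Reasoning
    off-diagonal : ∀ k → I a (punchIn a k) * x (punchIn a k) ≈ 0#
    off-diagonal k =
      trans (*-congʳ (reflexive (I-≢ (punchInᵢ≢i a k ∘ ≡.sym)))) (zeroˡ _)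

  I-⊗ : ∀ {n} (M : Mat n) → I ⊗ M ≈ₘ M
  I-⊗ M a b = sumFin-δ (λ k → M k b) a

  ⊗-I : ∀ {n} (M : Mat n) → M ⊗ I ≈ₘ M
  ⊗-I M a b = trans (sumFin-cong δ-comm) (sumFin-δ (M a) b)
    where
    δ-comm : ∀ k → M a k * I k b ≈ I b k * M a k
    δ-comm k = trans (*-comm (M a k) (I k b)) (*-congʳ (reflexive (I-cong {a = k} {b} ≡.sym ≡.sym)))

  ⊗-congˡ : ∀ {n} {X Y : Mat n} (M : Mat n) → X ≈ₘ Y → X ⊗ M ≈ₘ Y ⊗ M
  ⊗-congˡ M X≈Y a b = sumFin-cong (λ k → *-congʳ {M k b} (X≈Y a k))

  ⊗-congʳ : ∀ {n} {X Y : Mat n} (M : Mat n) → X ≈ₘ Y → M ⊗ X ≈ₘ M ⊗ Y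
  ⊗-congʳ M X≈Y a b = sumFin-cong (λ k → *-congˡ {M a k} (X≈Y k b))

  scaleRows-congʳ : ∀ {n} (d : Fin n → A) {X Y : Mat n} → X ≈ₘ Y → scaleRows d X ≈ₘ scaleRows d Y
  scaleRows-congʳ d X≈Y a b = *-congˡ (X≈Y a b)

  scaleCols-congʳ : ∀ {n} (d : Fin n → A) {X Y : Mat n} → X ≈ₘ Y → scaleCols d X ≈ₘ scaleCols d Y
  scaleCols-congʳ d X≈Y a b = *-congʳ (X≈Y a b)

  scaleRows-⊗ : ∀ {n} (d : Fin n → A) (X M : Mat n) → scaleRows d X ⊗ M ≈ₘ scaleRows d (X ⊗ M)
  scaleRows-⊗ d X M a b =
    trans (sumFin-cong (λ k → *-assoc (d a) (X a k) (M k b))) (sym (*-distribˡ-sumFin (d a) (λ k → X a k * M k b)))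

  ⊗-scaleCols : ∀ {n} (d : Fin n → A) (M X : Mat n) → M ⊗ scaleCols d X ≈ₘ scaleCols d (M ⊗ X)
  ⊗-scaleCols d M X a b =
    trans (sumFin-cong (λ k → sym (*-assoc (M a k) (X k b) (d b)))) (sym (*-distribʳ-sumFin (d b) (λ k → M a k * X k b)))

  -- Elementary matrices as row and column operations

  rowFactor-≡ : ∀ {n} {i a : Fin n} c → a ≡ i → rowFactor i c a ≡ c
  rowFactor-≡ {i = zero}  c ≡.refl = ≡.refl
  rowFactor-≡ {i = suc i} c ≡.refl = rowFactor-≡ {i = i} c ≡.refl

  rowFactor-≢ : ∀ {n} {i a : Fin n} c → a ≢ i → rowFactor i c a ≡ 1#
  rowFactor-≢ {i = zero}  {zero}  c a≢i = ⊥-elim (a≢i ≡.refl)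
  rowFactor-≢ {i = zero}  {suc a} c a≢i = ≡.refl
  rowFactor-≢ {i = suc i} {zero}  c a≢i = ≡.refl
  rowFactor-≢ {i = suc i} {suc a} c a≢i = rowFactor-≢ c (a≢i ∘ ≡.cong suc)

  rowFactor-³ : ∀ {n} (i : Fin n) c a → rowFactor i c a ³ ≈ rowFactor i (c ³) a
  rowFactor-³ zero    c zero    = refl
  rowFactor-³ zero    c (suc a) = trans (*-identityʳ _) (*-identityʳ _)
  rowFactor-³ (suc i) c zero    = trans (*-identityʳ _) (*-identityʳ _)
  rowFactor-³ (suc i) c (suc a) = rowFactor-³ i c a

  Escale≈scaleRows : ∀ {n} (i : Fin n) c → Escale i c ≈ₘ scaleRows (rowFactor i c) I
  Escale≈scaleRows i c a b with a ≟ i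
  ... | yes a≡i = *-congʳ (reflexive (≡.sym (rowFactor-≡ c a≡i)))
  ... | no  a≢i = trans (sym (*-identityˡ _)) (*-congʳ (reflexive (≡.sym (rowFactor-≢ c a≢i))))

  Escale-⊗ : ∀ {n} (i : Fin n) c (M : Mat n) → Escale i c ⊗ M ≈ₘ scaleRows (rowFactor i c) M
  Escale-⊗ i c M = begin
    Escale i c ⊗ M                       ≈⟨ ⊗-congˡ M (Escale≈scaleRows i c) ⟩
    scaleRows (rowFactor i c) I ⊗ M      ≈⟨ scaleRows-⊗ (rowFactor i c) I M ⟩
    scaleRows (rowFactor i c) (I ⊗ M)    ≈⟨ scaleRows-congʳ (rowFactor i c) (I-⊗ M) ⟩
    scaleRows (rowFactor i c) M          ∎
    where open ≈ₘ-Reasoning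

  ⊗-Escale : ∀ {n} (i : Fin n) c (M : Mat n) → M ⊗ Escale i c ≈ₘ scaleCols (rowFactor i c) M
  ⊗-Escale i c M = begin
    M ⊗ Escale i c                       ≈⟨ ⊗-congʳ M Escale≈scaleCols ⟩
    M ⊗ scaleCols (rowFactor i c) I      ≈⟨ ⊗-scaleCols (rowFactor i c) M I ⟩
    scaleCols (rowFactor i c) (M ⊗ I)    ≈⟨ scaleCols-congʳ (rowFactor i c) (⊗-I M) ⟩
    scaleCols (rowFactor i c) M          ∎
    where
    open ≈ₘ-Reasoning
    Escale≈scaleCols : Escale i c ≈ₘ scaleCols (rowFactor i c) I
    Escale≈scaleCols a b = trans (Escale≈scaleRows i c a b) (diagonal-comm (rowFactor i c) a b)

  swapIx-≡ˡ : ∀ {n} (i j : Fin n) {a} → a ≡ i → swapIx i j a ≡ j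
  swapIx-≡ˡ i j {a} a≡i with a ≟ i
  ... | yes _   = ≡.refl
  ... | no  a≢i = ⊥-elim (a≢i a≡i)

  swapIx-≡ʳ : ∀ {n} (i j : Fin n) {a} → a ≡ j → swapIx i j a ≡ i
  swapIx-≡ʳ i j {a} a≡j with a ≟ i
  ... | yes a≡i = ≡.trans (≡.sym a≡j) a≡i
  ... | no  _ with a ≟ j
  ...   | yes _   = ≡.refl
  ...   | no  a≢j = ⊥-elim (a≢j a≡j)

  swapIx-≢ : ∀ {n} (i j : Fin n) {a} → a ≢ i → a ≢ j → swapIx i j a ≡ a
  swapIx-≢ i j {a} a≢i a≢j with a ≟ i
  ... | yes a≡i = ⊥-elim (a≢i a≡i)
  ... | no  _ with a ≟ j
  ...   | yes a≡j = ⊥-elim (a≢j a≡j)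
  ...   | no  _   = ≡.refl

  ≡⊎≡⊎≢ : ∀ {n} (a i j : Fin n) → a ≡ i ⊎ a ≡ j ⊎ (a ≢ i × a ≢ j)
  ≡⊎≡⊎≢ a i j with a ≟ i | a ≟ j
  ... | yes a≡i | _       = inj₁ a≡i
  ... | no  _   | yes a≡j = inj₂ (inj₁ a≡j)
  ... | no  a≢i | no  a≢j = inj₂ (inj₂ (a≢i , a≢j))

  swapIx-comm : ∀ {n} (i j a : Fin n) → swapIx i j a ≡ swapIx j i a
  swapIx-comm i j a with ≡⊎≡⊎≢ a i j
  ... | inj₁ a≡i               = ≡.trans (swapIx-≡ˡ i j a≡i) (≡.sym (swapIx-≡ʳ j i a≡i))
  ... | inj₂ (inj₁ a≡j)        = ≡.trans (swapIx-≡ʳ i j a≡j) (≡.sym (swapIx-≡ˡ j i a≡j))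
  ... | inj₂ (inj₂ (a≢i , a≢j)) = ≡.trans (swapIx-≢ i j a≢i a≢j) (≡.sym (swapIx-≢ j i a≢j a≢i))

  swapIx-involutive : ∀ {n} (i j a : Fin n) → swapIx i j (swapIx i j a) ≡ a
  swapIx-involutive i j a with ≡⊎≡⊎≢ a i j
  ... | inj₁ a≡i =
    ≡.trans (≡.cong (swapIx i j) (swapIx-≡ˡ i j a≡i)) (≡.trans (swapIx-≡ʳ i j ≡.refl) (≡.sym a≡i))
  ... | inj₂ (inj₁ a≡j) =
    ≡.trans (≡.cong (swapIx i j) (swapIx-≡ʳ i j a≡j)) (≡.trans (swapIx-≡ˡ i j ≡.refl) (≡.sym a≡j))
  ... | inj₂ (inj₂ (a≢i , a≢j)) =
    ≡.trans (≡.cong (swapIx i j) (swapIx-≢ i j a≢i a≢j)) (swapIx-≢ i j a≢i a≢j)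

  swapIx-suc : ∀ {n} (i j a : Fin n) → swapIx (suc i) (suc j) (suc a) ≡ suc (swapIx i j a)
  swapIx-suc i j a with a ≟ i
  ... | yes _ = ≡.refl
  ... | no  _ with a ≟ j
  ...   | yes _ = ≡.refl
  ...   | no  _ = ≡.refl

  swapIx-zero-conj : ∀ {n} (k : Fin n) (a : Fin (suc (suc n))) →
    swapIx zero (suc (suc k)) a ≡ swapIx zero (suc zero) (swapIx (suc zero) (suc (suc k)) (swapIx zero (suc zero) a))
  swapIx-zero-conj k zero       = ≡.refl
  swapIx-zero-conj k (suc zero) = ≡.refl
  swapIx-zero-conj k (suc (suc a)) with suc (suc a) ≟ suc (suc k)
  ... | yes _ = ≡.refl
  ... | no  _ = ≡.refl

  Eswap-⊗ : ∀ {n} (i j : Fin n) (M : Mat n) → Eswap i j ⊗ M ≈ₘ permuteRows (swapIx i j) M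
  Eswap-⊗ i j M a = I-⊗ M (swapIx i j a)

  ⊗-Eswap : ∀ {n} (i j : Fin n) (M : Mat n) → M ⊗ Eswap i j ≈ₘ permuteCols (swapIx i j) M
  ⊗-Eswap i j M a b = trans (⊗-congʳ M Eswap≈permuteCols a b) (⊗-I M a (swapIx i j b))
    where
    Eswap≈permuteCols : Eswap i j ≈ₘ permuteCols (swapIx i j) I
    Eswap≈permuteCols k l = reflexive (I-cong
      (λ e → ≡.trans (≡.sym (swapIx-involutive i j k)) (≡.cong (swapIx i j) e))
      (λ e → ≡.trans (≡.cong (swapIx i j) e) (swapIx-involutive i j l)))

  -- Laplace expansion along the first column

  det-cong : ∀ {n} {M N : Mat n} → M ≈ₘ N → det M ≈ det N
  det-cong {zero}  _    = refl
  det-cong {suc n} M≈N =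
    sumFin-cong (λ j → *-congˡ {sgn j} (*-cong (M≈N zero j) (det-cong (λ a b → M≈N (suc a) (punchIn j b)))))

  sumFin-sgn-suc : ∀ {n} (g : Fin n → A) → sumFin (λ j → sgn (suc j) * g j) ≈ - sumFin (λ j → sgn j * g j)
  sumFin-sgn-suc g = sumFin-neg (λ j → sym (-‿distribˡ-* (sgn j) (g j)))

  sumFin-expansion-comm : ∀ {m n} (s a : Fin m → A) (t b : Fin n → A) (D : Fin m → Fin n → A) →
    sumFin (λ j → s j * (a j * sumFin (λ k → t k * (b k * D j k)))) ≈
    sumFin (λ k → t k * (b k * sumFin (λ j → s j * (a j * D j k))))
  sumFin-expansion-comm s a t b D = begin
    sumFin (λ j → s j * (a j * sumFin (λ k → t k * (b k * D j k))))
      ≈⟨ sumFin-cong (λ j → distribute (s j) (a j) (λ k → t k * (b k * D j k))) ⟩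
    sumFin (λ j → sumFin (λ k → s j * (a j * (t k * (b k * D j k)))))
      ≈⟨ sumFin-comm (λ j k → s j * (a j * (t k * (b k * D j k)))) ⟩
    sumFin (λ k → sumFin (λ j → s j * (a j * (t k * (b k * D j k)))))
      ≈⟨ sumFin-cong (λ k → sumFin-cong (λ j → reorder (s j) (a j) (t k) (b k) (D j k))) ⟩
    sumFin (λ k → sumFin (λ j → t k * (b k * (s j * (a j * D j k)))))
      ≈⟨ sumFin-cong (λ k → distribute (t k) (b k) (λ j → s j * (a j * D j k))) ⟨
    sumFin (λ k → t k * (b k * sumFin (λ j → s j * (a j * D j k)))) ∎
    where
    open ≈-Reasoning
    distribute : ∀ {n} x y (f : Fin n → A) → x * (y * sumFin f) ≈ sumFin (λ k → x * (y * f k))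
    distribute x y f = trans (*-congˡ (*-distribˡ-sumFin y f)) (*-distribˡ-sumFin x (λ k → y * f k))
    reorder : ∀ s a t b d → s * (a * (t * (b * d))) ≈ t * (b * (s * (a * d)))
    reorder = solve 5 (λ s a t b d → s ⊕ a ⊕ t ⊕ b ⊕ d ⊜ t ⊕ b ⊕ s ⊕ a ⊕ d) refl

  -- Past the common (0,0) term, expand the minors once more, along their first column on
  -- the left (by induction) and along their first row on the right: both sides become the
  -- double sum of -(sgn j * sgn k) M₀,ⱼ₊₁ Mₖ₊₁,₀ D j k.
  det-firstColumn : ∀ {n} (M : Mat (suc n)) →
    det M ≈ sumFin (λ k → sgn k * (M k zero * det (minor k zero M)))
  det-firstColumn {zero}  M = refl
  det-firstColumn {suc n} M = +-congˡ (begin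
    sumFin (λ j → sgn (suc j) * (M zero (suc j) * det (minor zero (suc j) M)))
      ≈⟨ sumFin-sgn-suc (λ j → M zero (suc j) * det (minor zero (suc j) M)) ⟩
    - sumFin (λ j → sgn j * (M zero (suc j) * det (minor zero (suc j) M)))
      ≈⟨ -‿cong (sumFin-cong {f = λ j → sgn j * (M zero (suc j) * det (minor zero (suc j) M))}
                             (λ j → *-congˡ (*-congˡ (det-firstColumn (minor zero (suc j) M))))) ⟩
    - sumFin (λ j → sgn j * (M zero (suc j) * sumFin (λ k → sgn k * (M (suc k) zero * D j k))))
      ≈⟨ -‿cong (sumFin-expansion-comm sgn (λ j → M zero (suc j)) sgn (λ k → M (suc k) zero) D) ⟩
    - sumFin (λ k → sgn k * (M (suc k) zero * sumFin (λ j → sgn j * (M zero (suc j) * D j k))))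
      ≈⟨ sumFin-sgn-suc (λ k → M (suc k) zero * det (minor (suc k) zero M)) ⟨
    sumFin (λ k → sgn (suc k) * (M (suc k) zero * det (minor (suc k) zero M))) ∎)
    where
    open ≈-Reasoning
    D : Fin (suc n) → Fin (suc n) → A
    D j k = det (λ x y → M (suc (punchIn k x)) (suc (punchIn j y)))

  det-transpose : ∀ {n} (M : Mat n) → det (transpose M) ≈ det M
  det-transpose {zero}  M = refl
  det-transpose {suc n} M =
    trans (sumFin-cong {f = λ j → sgn j * (M j zero * det (transpose (minor j zero M)))}
                       (λ j → *-congˡ (*-congˡ (det-transpose (minor j zero M)))))
          (sym (det-firstColumn M))

  -- Row and column operations on the determinant

  det-scaleRow : ∀ {n} (i : Fin n) c (M : Mat n) → det (scaleRows (rowFactor i c) M) ≈ c * det M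
  det-scaleRow {suc n} i c M =
    trans (sumFin-cong (expansion-term i)) (sym (*-distribˡ-sumFin c (λ j → sgn j * (M zero j * det (minor zero j M)))))
    where
    open ≈-Reasoning
    expansion-term : ∀ i j → sgn j * ((rowFactor i c zero * M zero j) * det (scaleRows (rowFactor i c ∘ suc) (minor zero j M)))
                 ≈ c * (sgn j * (M zero j * det (minor zero j M)))
    expansion-term zero j = begin
      sgn j * ((c * M zero j) * det (scaleRows (λ _ → 1#) (minor zero j M)))
        ≈⟨ *-congˡ (*-congˡ (det-cong (λ a b → *-identityˡ (M (suc a) (punchIn j b))))) ⟩
      sgn j * ((c * M zero j) * det (minor zero j M))
        ≈⟨ solve 4 (λ s c m d → s ⊕ (c ⊕ m) ⊕ d ⊜ c ⊕ s ⊕ m ⊕ d) refl _ _ _ _ ⟩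
      c * (sgn j * (M zero j * det (minor zero j M))) ∎
    expansion-term (suc i) j = begin
      sgn j * ((1# * M zero j) * det (scaleRows (rowFactor i c) (minor zero j M)))
        ≈⟨ *-congˡ (*-congˡ (det-scaleRow i c (minor zero j M))) ⟩
      sgn j * ((1# * M zero j) * (c * det (minor zero j M)))
        ≈⟨ solve 4 (λ s c m d → s ⊕ (id ⊕ m) ⊕ c ⊕ d ⊜ c ⊕ s ⊕ m ⊕ d) refl _ _ _ _ ⟩
      c * (sgn j * (M zero j * det (minor zero j M))) ∎

  det-scaleCol : ∀ {n} (j : Fin n) c (M : Mat n) → det (scaleCols (rowFactor j c) M) ≈ c * det M
  det-scaleCol j c M = begin
    det (scaleCols (rowFactor j c) M)                  ≈⟨ det-transpose (scaleCols (rowFactor j c) M) ⟨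
    det (transpose (scaleCols (rowFactor j c) M))      ≈⟨ det-cong (λ a b → *-comm (M b a) (rowFactor j c a)) ⟩
    det (scaleRows (rowFactor j c) (transpose M))      ≈⟨ det-scaleRow j c (transpose M) ⟩
    c * det (transpose M)                              ≈⟨ *-congˡ (det-transpose M) ⟩
    c * det M                                          ∎
    where open ≈-Reasoning

  *-neg-innermost : ∀ s m y → s * (m * - y) ≈ - (s * (m * y))
  *-neg-innermost s m y = trans (*-congˡ (sym (-‿distribʳ-* m y))) (sym (-‿distribʳ-* s _))

  neg-swap-terms : ∀ x y r → x + (- y + - r) ≈ - (y + (- x + r))
  neg-swap-terms x y r = begin
    x + (- y + - r)       ≈⟨ x∙yz≈y∙xz x (- y) (- r) ⟩
    - y + (x + - r)       ≈⟨ +-congˡ (+-congʳ (-‿involutive x)) ⟨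
    - y + (- - x + - r)   ≈⟨ +-congˡ (-‿+-comm (- x) r) ⟩
    - y + - (- x + r)     ≈⟨ -‿+-comm y (- x + r) ⟩
    - (y + (- x + r))     ∎
    where
    open ≈-Reasoning
    open import Algebra.Properties.CommutativeSemigroup +-commutativeSemigroup using (x∙yz≈y∙xz)

  -- In the first-row expansion the terms of columns 0 and 1 trade places with opposite
  -- signs, and the terms of the other columns change sign by induction.
  det-swapCols01 : ∀ {n} (M : Mat (suc (suc n))) → det (permuteCols (swapIx zero (suc zero)) M) ≈ - det M
  det-swapCols01 {n} M = begin
    det (permuteCols s M)
      ≈⟨ +-cong (*-identityˡ _) (+-cong (-1*x≈-x _) (swap-rest n M)) ⟩
    M zero (suc zero) * det (minor zero zero (permuteCols s M))
      + (- (M zero zero * det (minor zero (suc zero) (permuteCols s M))) + - rest M)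
      ≈⟨ +-cong (*-congˡ (det-cong (λ a → minor₀₀-swapped (M (suc a)))))
                (+-congʳ (-‿cong (*-congˡ (det-cong (λ a → minor₀₁-swapped (M (suc a))))))) ⟩
    M zero (suc zero) * det (minor zero (suc zero) M)
      + (- (M zero zero * det (minor zero zero M)) + - rest M)
      ≈⟨ neg-swap-terms _ _ _ ⟩
    - (M zero zero * det (minor zero zero M) + (- (M zero (suc zero) * det (minor zero (suc zero) M)) + rest M))
      ≈⟨ -‿cong (+-cong (*-identityˡ _) (+-congʳ (-1*x≈-x _))) ⟨
    - det M ∎
    where
    open ≈-Reasoning
    s : Fin (suc (suc n)) → Fin (suc (suc n))
    s = swapIx zero (suc zero)
    rest : ∀ {n} → Mat (suc (suc n)) → A
    rest {n} X = sumFin {n} (λ j → sgn (suc (suc j)) * (X zero (suc (suc j)) * det (minor zero (suc (suc j)) X)))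
    minor₀₀-swapped : ∀ (r : Fin (suc (suc n)) → A) b → r (s (suc b)) ≈ r (punchIn (suc zero) b)
    minor₀₀-swapped r zero    = refl
    minor₀₀-swapped r (suc b) = refl
    minor₀₁-swapped : ∀ (r : Fin (suc (suc n)) → A) b → r (s (punchIn (suc zero) b)) ≈ r (suc b)
    minor₀₁-swapped r zero    = refl
    minor₀₁-swapped r (suc b) = refl
    swap-rest : ∀ n (M : Mat (suc (suc n))) → rest (permuteCols (swapIx zero (suc zero)) M) ≈ - rest M
    swap-rest zero    M = sym -0#≈0#
    swap-rest (suc n) M = sumFin-neg (λ j → trans
      (*-congˡ (*-congˡ (trans (det-cong (λ a b → reflexive (≡.cong (M (suc a)) (punchIn-swap j b))))
                               (det-swapCols01 (minor zero (suc (suc j)) M)))))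
      (*-neg-innermost (sgn (suc (suc j))) (M zero (suc (suc j))) (det (minor zero (suc (suc j)) M))))
      where
      punchIn-swap : ∀ j b → swapIx zero (suc zero) (punchIn (suc (suc j)) b) ≡ punchIn (suc (suc j)) (swapIx zero (suc zero) b)
      punchIn-swap j zero          = ≡.refl
      punchIn-swap j (suc zero)    = ≡.refl
      punchIn-swap j (suc (suc b)) = ≡.refl

  det-swapRows01 : ∀ {n} (M : Mat (suc (suc n))) → det (permuteRows (swapIx zero (suc zero)) M) ≈ - det M
  det-swapRows01 M = begin
    det (permuteRows (swapIx zero (suc zero)) M)            ≈⟨ det-transpose (permuteRows (swapIx zero (suc zero)) M) ⟨
    det (permuteCols (swapIx zero (suc zero)) (transpose M)) ≈⟨ det-swapCols01 (transpose M) ⟩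
    - det (transpose M)                                     ≈⟨ -‿cong (det-transpose M) ⟩
    - det M                                                 ∎
    where open ≈-Reasoning

  det-swapRows : ∀ {n} (i j : Fin n) → i ≢ j → (M : Mat n) → det (permuteRows (swapIx i j) M) ≈ - det M
  det-swapRows-zero : ∀ {n} (j : Fin n) (M : Mat (suc n)) → det (permuteRows (swapIx zero (suc j)) M) ≈ - det M
  det-swapRows-suc : ∀ {n} (i j : Fin n) → i ≢ j → (M : Mat (suc n)) →
    det (permuteRows (swapIx (suc i) (suc j)) M) ≈ - det M

  det-swapRows zero    zero    i≢j M = ⊥-elim (i≢j ≡.refl)
  det-swapRows zero    (suc j) _   M = det-swapRows-zero j M
  det-swapRows (suc i) zero    _   M =
    trans (det-cong (λ a b → reflexive (≡.cong (λ x → M x b) (swapIx-comm (suc i) zero a)))) (det-swapRows-zero i M)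
  det-swapRows (suc i) (suc j) i≢j M = det-swapRows-suc i j (i≢j ∘ ≡.cong suc) M

  det-swapRows-zero zero    M = det-swapRows01 M
  det-swapRows-zero (suc k) M = begin
    det (permuteRows (swapIx zero (suc (suc k))) M)
      ≈⟨ det-cong (λ a b → reflexive (≡.cong (λ x → M x b) (swapIx-zero-conj k a))) ⟩
    det (permuteRows s₀₁ (permuteRows s₁ₖ (permuteRows s₀₁ M)))
      ≈⟨ det-swapRows01 (permuteRows s₁ₖ (permuteRows s₀₁ M)) ⟩
    - det (permuteRows s₁ₖ (permuteRows s₀₁ M))
      ≈⟨ -‿cong (det-swapRows-suc zero (suc k) (λ ()) (permuteRows s₀₁ M)) ⟩
    - - det (permuteRows s₀₁ M)
      ≈⟨ -‿involutive _ ⟩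
    det (permuteRows s₀₁ M)
      ≈⟨ det-swapRows01 M ⟩
    - det M ∎
    where
    open ≈-Reasoning
    s₀₁ s₁ₖ : Fin (suc (suc _)) → Fin (suc (suc _))
    s₀₁ = swapIx zero (suc zero)
    s₁ₖ = swapIx (suc zero) (suc (suc k))

  det-swapRows-suc i j i≢j M =
    sumFin-neg (λ l → trans (*-congˡ (*-congˡ (swapped-minor l))) (*-neg-innermost (sgn l) (M zero l) (det (minor zero l M))))
    where
    swapped-minor : ∀ l → det (minor zero l (permuteRows (swapIx (suc i) (suc j)) M)) ≈ - det (minor zero l M)
    swapped-minor l = trans
      (det-cong (λ a b → reflexive (≡.cong (λ x → M x (punchIn l b)) (swapIx-suc i j a))))
      (det-swapRows i j i≢j (minor zero l M))

  det-swapCols : ∀ {n} (i j : Fin n) → i ≢ j → (M : Mat n) → det (permuteCols (swapIx i j) M) ≈ - det M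
  det-swapCols i j i≢j M = begin
    det (permuteCols (swapIx i j) M)               ≈⟨ det-transpose (permuteCols (swapIx i j) M) ⟨
    det (permuteRows (swapIx i j) (transpose M))   ≈⟨ det-swapRows i j i≢j (transpose M) ⟩
    - det (transpose M)                            ≈⟨ -‿cong (det-transpose M) ⟩
    - det M                                        ∎
    where open ≈-Reasoning

  -- Comparing det and det ∘ cube

  record DetRatio {n} (r : A) (N M : Mat n) : Set ℓ where
    constructor detRatio
    field
      det≈      : det N ≈ r * det M
      det-cube≈ : det (cube N) ≈ r ³ * det (cube M)

  cube-cong : ∀ {n} {M N : Mat n} → M ≈ₘ N → cube M ≈ₘ cube N
  cube-cong M≈N a b = *-cong (*-cong (M≈N a b) (M≈N a b)) (M≈N a b)

  ³-distrib-* : ∀ x y → (x * y) ³ ≈ x ³ * y ³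
  ³-distrib-* = solve 2 (λ x y → ((x ⊕ y) ⊕ (x ⊕ y)) ⊕ (x ⊕ y) ⊜ ((x ⊕ x) ⊕ x) ⊕ ((y ⊕ y) ⊕ y)) refl

  ³-cong : ∀ {x y} → x ≈ y → x ³ ≈ y ³
  ³-cong x≈y = *-cong (*-cong x≈y x≈y) x≈y

  DetRatio-congˡ : ∀ {n} {r s} {N M : Mat n} → r ≈ s → DetRatio r N M → DetRatio s N M
  DetRatio-congˡ r≈s (detRatio d d³) = detRatio (trans d (*-congʳ r≈s)) (trans d³ (*-congʳ (³-cong r≈s)))

  DetRatio-respˡ : ∀ {n} {r} {N N′ M : Mat n} → N ≈ₘ N′ → DetRatio r N′ M → DetRatio r N M
  DetRatio-respˡ N≈N′ (detRatio d d³) = detRatio (trans (det-cong N≈N′) d) (trans (det-cong (cube-cong N≈N′)) d³)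

  DetRatio-trans : ∀ {n} {r s} {N M L : Mat n} → DetRatio r N M → DetRatio s M L → DetRatio (r * s) N L
  DetRatio-trans {r = r} {s} (detRatio d₁ d₁³) (detRatio d₂ d₂³) = detRatio
    (trans d₁ (trans (*-congˡ d₂) (sym (*-assoc _ _ _))))
    (trans d₁³ (trans (*-congˡ d₂³) (trans (sym (*-assoc _ _ _)) (*-congʳ (sym (³-distrib-* r s))))))

  DetRatio-transpose : ∀ {n} (M : Mat n) → DetRatio 1# (transpose M) M
  DetRatio-transpose M = detRatio
    (trans (det-transpose M) (sym (*-identityˡ _)))
    (trans (det-transpose (cube M)) (solve 1 (λ x → x ⊜ ((id ⊕ id) ⊕ id) ⊕ x) refl _))

  DetRatio-scaleRow : ∀ {n} (i : Fin n) c (M : Mat n) → DetRatio c (scaleRows (rowFactor i c) M) M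
  DetRatio-scaleRow i c M = detRatio
    (det-scaleRow i c M)
    (trans (det-cong (λ a b → trans (³-distrib-* _ _) (*-congʳ (rowFactor-³ i c a)))) (det-scaleRow i (c ³) (cube M)))

  DetRatio-scaleCol : ∀ {n} (j : Fin n) c (M : Mat n) → DetRatio c (scaleCols (rowFactor j c) M) M
  DetRatio-scaleCol j c M = detRatio
    (det-scaleCol j c M)
    (trans (det-cong (λ a b → trans (³-distrib-* _ _) (*-congˡ (rowFactor-³ j c b)))) (det-scaleCol j (c ³) (cube M)))

  -1³≈-1 : (- 1#) ³ ≈ - 1#
  -1³≈-1 = trans (*-congʳ (trans (-1*x≈-x (- 1#)) (-‿involutive 1#))) (*-identityˡ _)

  DetRatio-swapRows : ∀ {n} (i j : Fin n) → i ≢ j → (M : Mat n) → DetRatio (- 1#) (permuteRows (swapIx i j) M) M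
  DetRatio-swapRows i j i≢j M = detRatio
    (trans (det-swapRows i j i≢j M) (sym (-1*x≈-x _)))
    (trans (det-swapRows i j i≢j (cube M)) (sym (trans (*-congʳ -1³≈-1) (-1*x≈-x _))))

  DetRatio-swapCols : ∀ {n} (i j : Fin n) → i ≢ j → (M : Mat n) → DetRatio (- 1#) (permuteCols (swapIx i j) M) M
  DetRatio-swapCols i j i≢j M = detRatio
    (trans (det-swapCols i j i≢j M) (sym (-1*x≈-x _)))
    (trans (det-swapCols i j i≢j (cube M)) (sym (trans (*-congʳ -1³≈-1) (-1*x≈-x _))))

  DetRatio-Escale²-⊗ : ∀ {n} (i₁ i₂ : Fin n) c (M : Mat n) → DetRatio (c * c) ((Escale i₁ c ⊗ Escale i₂ c) ⊗ M) M
  DetRatio-Escale²-⊗ i₁ i₂ c M =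
    DetRatio-respˡ product≈ (DetRatio-trans (DetRatio-scaleRow i₁ c (scaleRows (rowFactor i₂ c) M))
                                            (DetRatio-scaleRow i₂ c M))
    where
    open ≈ₘ-Reasoning
    product≈ : (Escale i₁ c ⊗ Escale i₂ c) ⊗ M ≈ₘ scaleRows (rowFactor i₁ c) (scaleRows (rowFactor i₂ c) M)
    product≈ = begin
      (Escale i₁ c ⊗ Escale i₂ c) ⊗ M                  ≈⟨ ⊗-congˡ M (Escale-⊗ i₁ c (Escale i₂ c)) ⟩
      scaleRows (rowFactor i₁ c) (Escale i₂ c) ⊗ M     ≈⟨ scaleRows-⊗ (rowFactor i₁ c) (Escale i₂ c) M ⟩
      scaleRows (rowFactor i₁ c) (Escale i₂ c ⊗ M)     ≈⟨ scaleRows-congʳ (rowFactor i₁ c) (Escale-⊗ i₂ c M) ⟩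
      scaleRows (rowFactor i₁ c) (scaleRows (rowFactor i₂ c) M) ∎

  DetRatio-⊗-Escale² : ∀ {n} (i₁ i₂ : Fin n) c (M : Mat n) → DetRatio (c * c) (M ⊗ (Escale i₁ c ⊗ Escale i₂ c)) M
  DetRatio-⊗-Escale² i₁ i₂ c M =
    DetRatio-respˡ product≈ (DetRatio-trans (DetRatio-scaleCol i₂ c (scaleCols (rowFactor i₁ c) M))
                                            (DetRatio-scaleCol i₁ c M))
    where
    open ≈ₘ-Reasoning
    product≈ : M ⊗ (Escale i₁ c ⊗ Escale i₂ c) ≈ₘ scaleCols (rowFactor i₂ c) (scaleCols (rowFactor i₁ c) M)
    product≈ = begin
      M ⊗ (Escale i₁ c ⊗ Escale i₂ c)                  ≈⟨ ⊗-congʳ M (⊗-Escale i₂ c (Escale i₁ c)) ⟩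
      M ⊗ scaleCols (rowFactor i₂ c) (Escale i₁ c)     ≈⟨ ⊗-scaleCols (rowFactor i₂ c) M (Escale i₁ c) ⟩
      scaleCols (rowFactor i₂ c) (M ⊗ Escale i₁ c)     ≈⟨ scaleCols-congʳ (rowFactor i₂ c) (⊗-Escale i₁ c M) ⟩
      scaleCols (rowFactor i₂ c) (scaleCols (rowFactor i₁ c) M) ∎

  DetRatio-Eswap²-⊗ : ∀ {n} (i₁ i₂ j₁ j₂ : Fin n) → i₁ ≢ i₂ → j₁ ≢ j₂ → (M : Mat n) →
    DetRatio (- 1# * - 1#) ((Eswap i₁ i₂ ⊗ Eswap j₁ j₂) ⊗ M) M
  DetRatio-Eswap²-⊗ i₁ i₂ j₁ j₂ i₁≢i₂ j₁≢j₂ M =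
    DetRatio-respˡ product≈ (DetRatio-trans (DetRatio-swapRows i₁ i₂ i₁≢i₂ (permuteRows (swapIx j₁ j₂) M))
                                            (DetRatio-swapRows j₁ j₂ j₁≢j₂ M))
    where
    product≈ : (Eswap i₁ i₂ ⊗ Eswap j₁ j₂) ⊗ M ≈ₘ permuteRows (swapIx i₁ i₂) (permuteRows (swapIx j₁ j₂) M)
    product≈ a b = trans (⊗-congˡ M (Eswap-⊗ i₁ i₂ (Eswap j₁ j₂)) a b) (Eswap-⊗ j₁ j₂ M (swapIx i₁ i₂ a) b)

  DetRatio-⊗-Eswap² : ∀ {n} (i₁ i₂ j₁ j₂ : Fin n) → i₁ ≢ i₂ → j₁ ≢ j₂ → (M : Mat n) →
    DetRatio (- 1# * - 1#) (M ⊗ (Eswap i₁ i₂ ⊗ Eswap j₁ j₂)) M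
  DetRatio-⊗-Eswap² i₁ i₂ j₁ j₂ i₁≢i₂ j₁≢j₂ M =
    DetRatio-respˡ product≈ (DetRatio-trans (DetRatio-swapCols j₁ j₂ j₁≢j₂ (permuteCols (swapIx i₁ i₂) M))
                                            (DetRatio-swapCols i₁ i₂ i₁≢i₂ M))
    where
    product≈ : M ⊗ (Eswap i₁ i₂ ⊗ Eswap j₁ j₂) ≈ₘ permuteCols (swapIx j₁ j₂) (permuteCols (swapIx i₁ i₂) M)
    product≈ a b = trans (⊗-congʳ M (⊗-Eswap j₁ j₂ (Eswap i₁ i₂)) a b) (⊗-Eswap i₁ i₂ M a (swapIx j₁ j₂ b))

  DetRatio-Eswap-⊗-Eswap : ∀ {n} (i₁ i₂ j₁ j₂ : Fin n) → i₁ ≢ i₂ → j₁ ≢ j₂ → (M : Mat n) →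
    DetRatio (- 1# * - 1#) ((Eswap i₁ i₂ ⊗ M) ⊗ Eswap j₁ j₂) M
  DetRatio-Eswap-⊗-Eswap i₁ i₂ j₁ j₂ i₁≢i₂ j₁≢j₂ M =
    DetRatio-respˡ product≈ (DetRatio-trans (DetRatio-swapCols j₁ j₂ j₁≢j₂ (permuteRows (swapIx i₁ i₂) M))
                                            (DetRatio-swapRows i₁ i₂ i₁≢i₂ M))
    where
    product≈ : (Eswap i₁ i₂ ⊗ M) ⊗ Eswap j₁ j₂ ≈ₘ permuteCols (swapIx j₁ j₂) (permuteRows (swapIx i₁ i₂) M)
    product≈ a b = trans (⊗-Eswap j₁ j₂ (Eswap i₁ i₂ ⊗ M) a b) (Eswap-⊗ i₁ i₂ M a (swapIx j₁ j₂ b))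

  DetRatio-Escale-⊗-Escale : ∀ {n} (i j : Fin n) α β (M : Mat n) →
    DetRatio (β * α) ((Escale i α ⊗ M) ⊗ Escale j β) M
  DetRatio-Escale-⊗-Escale i j α β M =
    DetRatio-respˡ product≈ (DetRatio-trans (DetRatio-scaleCol j β (scaleRows (rowFactor i α) M))
                                            (DetRatio-scaleRow i α M))
    where
    open ≈ₘ-Reasoning
    product≈ : (Escale i α ⊗ M) ⊗ Escale j β ≈ₘ scaleCols (rowFactor j β) (scaleRows (rowFactor i α) M)
    product≈ = begin
      (Escale i α ⊗ M) ⊗ Escale j β                    ≈⟨ ⊗-congˡ (Escale j β) (Escale-⊗ i α M) ⟩
      scaleRows (rowFactor i α) M ⊗ Escale j β         ≈⟨ ⊗-Escale j β _ ⟩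
      scaleCols (rowFactor j β) (scaleRows (rowFactor i α) M) ∎

module DeterminantMonomorphism
  {c₁ ℓ₁ c₂ ℓ₂} (R : CommutativeRing c₁ ℓ₁) (S : CommutativeRing c₂ ℓ₂)
  {f : CommutativeRing.Carrier R → CommutativeRing.Carrier S}
  (f-mono : IsRingMonomorphism (CommutativeRing.rawRing R) (CommutativeRing.rawRing S) f)
  where

  private
    module R = Determinant R
    module S = Determinant S
  open IsRingMonomorphism f-mono
  open CommutativeRing R using () renaming (_*_ to _*ᴿ_)
  open CommutativeRing S using (_≈_; _*_; sym; trans; +-congˡ; *-cong; *-congˡ; *-congʳ; -‿cong; setoid)
  open SetoidReasoning setoid

  mapMat : ∀ {n} → R.Mat n → S.Mat n
  mapMat M a b = f (M a b)

  sumFin-homo : ∀ {n} (g : Fin n → CommutativeRing.Carrier R) → f (R.sumFin g) ≈ S.sumFin (f ∘ g)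
  sumFin-homo {zero}  g = 0#-homo
  sumFin-homo {suc n} g = trans (+-homo _ _) (+-congˡ (sumFin-homo (g ∘ suc)))

  sgn-homo : ∀ {n} (j : Fin n) → f (R.sgn j) ≈ S.sgn j
  sgn-homo zero    = 1#-homo
  sgn-homo (suc j) = trans (-‿homo _) (-‿cong (sgn-homo j))

  det-homo : ∀ {n} (M : R.Mat n) → f (R.det M) ≈ S.det (mapMat M)
  det-homo {zero}  M = 1#-homo
  det-homo {suc n} M = trans (sumFin-homo (λ j → R.sgn j *ᴿ (M zero j *ᴿ minorDet j))) (S.sumFin-cong term-homo)
    where
    minorDet : Fin (suc n) → CommutativeRing.Carrier R
    minorDet j = R.det (R.minor zero j M)
    term-homo : ∀ j → f (R.sgn j *ᴿ (M zero j *ᴿ minorDet j))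
                    ≈ S.sgn j * (f (M zero j) * S.det (mapMat (R.minor zero j M)))
    term-homo j = trans (*-homo (R.sgn j) (M zero j *ᴿ minorDet j))
      (*-cong (sgn-homo j) (trans (*-homo (M zero j) (minorDet j)) (*-congˡ (det-homo (R.minor zero j M)))))

  ³-homo : ∀ x → f (x R.³) ≈ f x S.³
  ³-homo x = trans (*-homo _ _) (*-congʳ (*-homo _ _))

  det-cube-homo : ∀ {n} (M : R.Mat n) → f (R.det (R.cube M)) ≈ S.det (S.cube (mapMat M))
  det-cube-homo M = trans (det-homo (R.cube M)) (S.det-cong (λ a b → ³-homo (M a b)))

  DetRatio-reflect : ∀ {n} {r} {N M : R.Mat n} → S.DetRatio (f r) (mapMat N) (mapMat M) → R.DetRatio r N M
  DetRatio-reflect {r = r} {N} {M} (S.detRatio d d³) = R.detRatio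
    (injective (begin
      f (R.det N)             ≈⟨ det-homo N ⟩
      S.det (mapMat N)        ≈⟨ d ⟩
      f r * S.det (mapMat M)  ≈⟨ *-congˡ (det-homo M) ⟨
      f r * f (R.det M)       ≈⟨ *-homo _ _ ⟨
      f (r *ᴿ R.det M)       ∎))
    (injective (begin
      f (R.det (R.cube N))                  ≈⟨ det-cube-homo N ⟩
      S.det (S.cube (mapMat N))             ≈⟨ d³ ⟩
      f r S.³ * S.det (S.cube (mapMat M))   ≈⟨ *-cong (³-homo r) (det-cube-homo M) ⟨
      f (r R.³) * f (R.det (R.cube M))      ≈⟨ *-homo _ _ ⟨
      f (r R.³ *ᴿ R.det (R.cube M))        ∎))

ℤ→ℚ : ℤ → ℚ
ℤ→ℚ z = z ℚ./ 1

toℚᵘ-ℤ→ℚ : ∀ z → ℚ.toℚᵘ (ℤ→ℚ z) ℚᵘ.≃ ℚᵘ.mkℚᵘ z 0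
toℚᵘ-ℤ→ℚ z = ℚP.toℚᵘ-fromℚᵘ (ℚᵘ.mkℚᵘ z 0)

ℤ→ℚ-+ : ∀ a b → ℤ→ℚ (a ℤ.+ b) ≡ ℤ→ℚ a ℚ.+ ℤ→ℚ b
ℤ→ℚ-+ a b = ℚP.toℚᵘ-injective (begin
  ℚ.toℚᵘ (ℤ→ℚ (a ℤ.+ b))              ≈⟨ toℚᵘ-ℤ→ℚ (a ℤ.+ b) ⟩
  ℚᵘ.mkℚᵘ (a ℤ.+ b) 0
    ≈⟨ ℚᵘ.*≡* (≡.cong₂ (λ x y → (x ℤ.+ y) ℤ.* 1ℤ) (≡.sym (ℤP.*-identityʳ a)) (≡.sym (ℤP.*-identityʳ b))) ⟩
  ℚᵘ.mkℚᵘ a 0 ℚᵘ.+ ℚᵘ.mkℚᵘ b 0         ≈⟨ ℚᵘP.+-cong (toℚᵘ-ℤ→ℚ a) (toℚᵘ-ℤ→ℚ b) ⟨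
  ℚ.toℚᵘ (ℤ→ℚ a) ℚᵘ.+ ℚ.toℚᵘ (ℤ→ℚ b)  ≈⟨ ℚP.toℚᵘ-homo-+ (ℤ→ℚ a) (ℤ→ℚ b) ⟨
  ℚ.toℚᵘ (ℤ→ℚ a ℚ.+ ℤ→ℚ b)            ∎)
  where open ℚᵘP.≃-Reasoning

ℤ→ℚ-* : ∀ a b → ℤ→ℚ (a ℤ.* b) ≡ ℤ→ℚ a ℚ.* ℤ→ℚ b
ℤ→ℚ-* a b = ℚP.toℚᵘ-injective (begin
  ℚ.toℚᵘ (ℤ→ℚ (a ℤ.* b))              ≈⟨ toℚᵘ-ℤ→ℚ (a ℤ.* b) ⟩
  ℚᵘ.mkℚᵘ a 0 ℚᵘ.* ℚᵘ.mkℚᵘ b 0         ≈⟨ ℚᵘP.*-cong (toℚᵘ-ℤ→ℚ a) (toℚᵘ-ℤ→ℚ b) ⟨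
  ℚ.toℚᵘ (ℤ→ℚ a) ℚᵘ.* ℚ.toℚᵘ (ℤ→ℚ b)  ≈⟨ ℚP.toℚᵘ-homo-* (ℤ→ℚ a) (ℤ→ℚ b) ⟨
  ℚ.toℚᵘ (ℤ→ℚ a ℚ.* ℤ→ℚ b)            ∎)
  where open ℚᵘP.≃-Reasoning

ℤ→ℚ-neg : ∀ a → ℤ→ℚ (ℤ.- a) ≡ ℚ.- ℤ→ℚ a
ℤ→ℚ-neg a = ℚP.toℚᵘ-injective (begin
  ℚ.toℚᵘ (ℤ→ℚ (ℤ.- a))    ≈⟨ toℚᵘ-ℤ→ℚ (ℤ.- a) ⟩
  ℚᵘ.- ℚᵘ.mkℚᵘ a 0         ≈⟨ ℚᵘP.-‿cong (toℚᵘ-ℤ→ℚ a) ⟨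
  ℚᵘ.- ℚ.toℚᵘ (ℤ→ℚ a)      ≈⟨ ℚP.toℚᵘ-homo‿- (ℤ→ℚ a) ⟨
  ℚ.toℚᵘ (ℚ.- ℤ→ℚ a)      ∎)
  where open ℚᵘP.≃-Reasoning

ℤ→ℚ-injective : ∀ {a b} → ℤ→ℚ a ≡ ℤ→ℚ b → a ≡ b
ℤ→ℚ-injective {a} {b} eq
  with ℚᵘP.≃-trans (ℚᵘP.≃-sym (toℚᵘ-ℤ→ℚ a)) (ℚᵘP.≃-trans (ℚP.toℚᵘ-cong eq) (toℚᵘ-ℤ→ℚ b))
... | ℚᵘ.*≡* a*1≡b*1 = ≡.trans (≡.sym (ℤP.*-identityʳ a)) (≡.trans a*1≡b*1 (ℤP.*-identityʳ b))

ℤ→ℚ-isRingMonomorphism : IsRingMonomorphism ℤ.+-*-rawRing ℚ.+-*-rawRing ℤ→ℚ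
ℤ→ℚ-isRingMonomorphism = record
  { isRingHomomorphism = record
    { isSemiringHomomorphism = record
      { isNearSemiringHomomorphism = record
        { +-isMonoidHomomorphism = record
          { isMagmaHomomorphism = record
            { isRelHomomorphism = record { cong = ≡.cong ℤ→ℚ }
            ; homo = ℤ→ℚ-+
            }
          ; ε-homo = ≡.refl
          }
        ; *-homo = ℤ→ℚ-*
        }
      ; 1#-homo = ≡.refl
      }
    ; -‿homo = ℤ→ℚ-neg
    }
  ; injective = ℤ→ℚ-injective
  }

module Detℤ = Determinant ℤP.+-*-commutativeRing
module Detℚ = Determinant ℚP.+-*-commutativeRing
module Detℤ→ℚ = DeterminantMonomorphism ℤP.+-*-commutativeRing ℚP.+-*-commutativeRing ℤ→ℚ-isRingMonomorphism

lemma2p1 : (n : ℕ) → 2 ≤ n → (M : ℤM.Mat n) →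
    ℤM.det M ≡ 1ℤ → ℤM.det (ℤM.cube M) ≡ 1ℤ →
    -- (i)
    Good (ℤM.transpose M)
    -- (ii)
    × (∀ (i₁ i₂ : Fin n) → i₁ ≢ i₂ →
        Good ((ℤM.Escale i₁ (Data.Integer.- 1ℤ) ℤM.⊗ ℤM.Escale i₂ (Data.Integer.- 1ℤ)) ℤM.⊗ M)
        × Good (M ℤM.⊗ (ℤM.Escale i₁ (Data.Integer.- 1ℤ) ℤM.⊗ ℤM.Escale i₂ (Data.Integer.- 1ℤ))))
    -- (iii)
    × (∀ (i₁ i₂ j₁ j₂ : Fin n) → i₁ ≢ i₂ → j₁ ≢ j₂ →
        Good ((ℤM.Eswap i₁ i₂ ℤM.⊗ ℤM.Eswap j₁ j₂) ℤM.⊗ M)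
        × Good (M ℤM.⊗ (ℤM.Eswap i₁ i₂ ℤM.⊗ ℤM.Eswap j₁ j₂))
        × Good ((ℤM.Eswap i₁ i₂ ℤM.⊗ M) ℤM.⊗ ℤM.Eswap j₁ j₂))
    -- (iv)
    × (∀ (i j : Fin n) (α : ℚ) .{{_ : NonZero α}} (N : ℤM.Mat n) →
        (∀ a b → toℚMat N a b ≡ ((ℚM.Escale i α ℚM.⊗ toℚMat M) ℚM.⊗ ℚM.Escale j (1/ α)) a b) →
        Good N)
lemma2p1 n _ M det≡1 det³≡1 =
    good (Detℤ.DetRatio-transpose M)
  , (λ i₁ i₂ _ →
        good (Detℤ.DetRatio-Escale²-⊗ i₁ i₂ (ℤ.- 1ℤ) M)
      , good (Detℤ.DetRatio-⊗-Escale² i₁ i₂ (ℤ.- 1ℤ) M))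
  , (λ i₁ i₂ j₁ j₂ i₁≢i₂ j₁≢j₂ →
        good (Detℤ.DetRatio-Eswap²-⊗ i₁ i₂ j₁ j₂ i₁≢i₂ j₁≢j₂ M)
      , good (Detℤ.DetRatio-⊗-Eswap² i₁ i₂ j₁ j₂ i₁≢i₂ j₁≢j₂ M)
      , good (Detℤ.DetRatio-Eswap-⊗-Eswap i₁ i₂ j₁ j₂ i₁≢i₂ j₁≢j₂ M))
  , (λ i j α N N≈ → good (Detℤ→ℚ.DetRatio-reflect (Detℚ.DetRatio-respˡ N≈
        (Detℚ.DetRatio-congˡ (ℚP.*-inverseˡ α)
          (Detℚ.DetRatio-Escale-⊗-Escale i j α (1/ α) (toℚMat M))))))
  where
  -- The factor (- 1ℤ) * (- 1ℤ) of (ii) and (iii), and its cube, reduce to 1ℤ by evaluation.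
  good : ∀ {N} → Detℤ.DetRatio 1ℤ N M → Good N
  good (Detℤ.detRatio d d³) = ≡.trans d (≡.cong (1ℤ ℤ.*_) det≡1) , ≡.trans d³ (≡.cong (1ℤ ℤ.*_) det³≡1)
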